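{- Fix $k\ge2$ and let $\pi$ be a permutation containing a decreasing subsequence of length $k$, with B-sequence $b_k\cdots b_1$. Let $x\le b_k$ be a letter. Then the label of $x$ in $\psi(\pi)$ is not larger than the label of $x$ in $\pi$.
   Context: Letters of a permutation are identified with their values. The B-sequence $b_k\cdots b_1$ of $\pi$ is defined recursively: $b_1$ is the leftmost letter that is the last letter of a decreasing subsequence of length $k$, and for $j\ge2$, $b_j$ is the leftmost letter such that $b_j\cdots b_1$ is a suffix of a decreasing subsequence of length $k$. The B-shift $\psi(\pi)$ is obtained by moving, for $m=k,\ldots,2$, the letter $b_{m-1}$ to the position previously occupied by $b_m$, and moving $b_k$ to the position previously occupied by $b_1$, other letters fixed. The label of a letter $x$ in a permutation $\sigma$ is the maximal length of a decreasing subsequence of $\sigma$ starting at $x$. -}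

module Defs where

open import Data.Nat using (ℕ; suc; _<_; _>_; _≤_; _≡ᵇ_)
open import Data.Bool using (if_then_else_)
open import Data.List using (List; []; _∷_; _++_; [_]; length; map; upTo)
open import Data.List.Relation.Unary.Linked using (Linked)
open import Data.List.Relation.Binary.Sublist.Propositional using (_⊆_)
open import Data.List.Relation.Binary.Permutation.Propositional using (_↭_)
open import Data.Product using (Σ; ∃; _×_)
open import Relation.Binary.PropositionalEquality using (_≡_)
open import Relation.Nullary using (¬_)

IsPerm : ℕ → List ℕ → Set
IsPerm n π = π ↭ map suc (upTo n)

DecSub : List ℕ → List ℕ → Set
DecSub σ d = (d ⊆ σ) × Linked _>_ d

LeftOf : List ℕ → ℕ → ℕ → Set
LeftOf σ y z = Σ (List ℕ) λ as → Σ (List ℕ) λ bs → Σ (List ℕ) λ cs →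
  σ ≡ as ++ (y ∷ bs ++ (z ∷ cs))

GoodSuffix : List ℕ → ℕ → List ℕ → Set
GoodSuffix σ k s = Σ (List ℕ) λ d → DecSub σ d × (length d ≡ k) ×
  (Σ (List ℕ) λ p → p ++ s ≡ d)

-- IsBTail π k (b_j ∷ … ∷ b_1): the first j letters b_1,…,b_j of the
-- B-sequence, each b_i the leftmost letter y with y b_{i-1}⋯b_1 a good suffix
data IsBTail (π : List ℕ) (k : ℕ) : List ℕ → Set where
  nil  : IsBTail π k []
  cons : ∀ {y s} → IsBTail π k s → GoodSuffix π k (y ∷ s) →
         (∀ z → LeftOf π z y → ¬ GoodSuffix π k (z ∷ s)) →
         IsBTail π k (y ∷ s)

IsBSeq : List ℕ → ℕ → List ℕ → Set
IsBSeq π k bs = IsBTail π k bs × (length bs ≡ k)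

rot : List ℕ → List ℕ
rot []       = []
rot (x ∷ xs) = xs ++ [ x ]

repl : List ℕ → List ℕ → ℕ → ℕ
repl (a ∷ as) (c ∷ cs) y = if y ≡ᵇ a then c else repl as cs y
repl _        _        y = y

-- B-shift: the position of b_m (m ≥ 2) receives b_{m-1}, the position of
-- b_1 receives b_k, all other letters fixed
ψ : List ℕ → List ℕ → List ℕ
ψ bs π = map (repl bs (rot bs)) π

IsLabel : List ℕ → ℕ → ℕ → Set
IsLabel σ x L =
  (Σ (List ℕ) λ d → DecSub σ (x ∷ d) × (length (x ∷ d) ≡ L)) ×
  (∀ d → DecSub σ (x ∷ d) → length (x ∷ d) ≤ L)

module Submission where

-- ψ(π) = map f π, where f (shift below) sends b_m to b_{m-1}, b_1 to b_k and fixes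
-- every other letter.  A decreasing subsequence x = f(u₀) > f(u₁) > ⋯ of ψ(π) is
-- pulled back from the right to a decreasing subsequence of π starting at x that is at
-- least as long.
-- The only obstruction is a pair u before v whose images f(v), f(u) appear in that
-- order in π.  Since x ≤ b_k and b_k ⋯ b_1 is decreasing, this forces u = b_m, v ∉ B
-- and u before v before f(u) = b_{m-1}.  The decreasing subsequence from v is then
-- handed down along b_{m-1} > b_{m-2} > ⋯: a letter z of it lying before some b_j
-- with z > b_{j-1} (or j = 1) would, after b_k ⋯ b_m and the letters of the
-- subsequence preceding z, end a decreasing subsequence of length k with suffix
-- z b_{j-1} ⋯ b_1, contradicting the leftmost choice of b_j.

open import Defs
open import Data.Bool using (true; false)
open import Data.Empty using (⊥; ⊥-elim)
open import Data.List using (List; []; _∷_; _++_; [_]; length; map)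
open import Data.List.Properties using (++-assoc; length-++; length-map; ∷ʳ-++)
open import Data.List.Membership.Propositional using (_∈_; _∉_)
open import Data.List.Membership.Propositional.Properties using (∈-∃++; ∈-++⁺ʳ)
open import Data.List.Relation.Unary.Any using (here; there)
open import Data.List.Relation.Unary.All using () renaming (lookup to All-lookup)
open import Data.List.Relation.Unary.AllPairs using (AllPairs; _∷_)
open import Data.List.Relation.Unary.Linked using (Linked; []; [-]; _∷_; tail)
open import Data.List.Relation.Unary.Linked.Properties using (Linked⇒AllPairs; map⁻)
open import Data.List.Relation.Unary.Unique.Propositional using (Unique)
open import Data.List.Relation.Unary.Unique.Propositional.Properties
  using (upTo⁺) renaming (map⁺ to Unique-map⁺)
open import Data.List.Relation.Binary.Sublist.Propositional
  using (_⊆_; []; _∷_; _∷ʳ_; ⊆-refl; ⊆-trans; from∈; to∈; minimum)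
open import Data.List.Relation.Binary.Sublist.Propositional.Properties
  using (Any-resp-⊆; ∷ˡ⁻; ++⁺ʳ; ++⁺ˡ)
open import Data.List.Relation.Binary.Permutation.Propositional using (↭-sym; ↭⇒↭ₛ)
import Data.List.Relation.Binary.Permutation.Setoid.Properties as Permutation
open import Data.Nat using (ℕ; suc; _+_; _≤_; _<_; _>_; _≡ᵇ_; z≤n; s≤s)
open import Data.Nat.Properties
open import Data.List.Membership.DecPropositional _≟_ using (_∈?_)
open import Data.Product using (Σ; ∃₂; _×_; _,_; proj₁; proj₂)
open import Data.Sum using (_⊎_; inj₁; inj₂) renaming (map to ⊎-map)
open import Function using (_∘_; _on_; flip)
open import Relation.Binary.PropositionalEquality hiding ([_])
open import Relation.Nullary using (¬_; yes; no)
open import Relation.Binary.Definitions using (tri<; tri≈; tri>)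

IsPerm⇒Unique : ∀ {n π} → IsPerm n π → Unique π
IsPerm⇒Unique {n} π↭ =
  Permutation.Unique-resp-↭ (setoid ℕ) (↭⇒↭ₛ (↭-sym π↭)) (Unique-map⁺ suc-injective (upTo⁺ n))

length-∷ʳ : ∀ {A : Set} (xs : List A) {x} → length (xs ++ [ x ]) ≡ suc (length xs)
length-∷ʳ xs = trans (length-++ xs) (+-comm (length xs) 1)

⊆-map-preimage : ∀ {A B : Set} (f : A → B) xs {ys} → ys ⊆ map f xs →
                 Σ (List A) λ zs → zs ⊆ xs × map f zs ≡ ys
⊆-map-preimage f []       []         = [] , [] , refl
⊆-map-preimage f (x ∷ xs) (_ ∷ʳ ys⊆) with ⊆-map-preimage f xs ys⊆
... | zs , zs⊆ , refl = zs , x ∷ʳ zs⊆ , refl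
⊆-map-preimage f (x ∷ xs) (refl ∷ ys⊆) with ⊆-map-preimage f xs ys⊆
... | zs , zs⊆ , refl = x ∷ zs , refl ∷ zs⊆ , refl

module _ {A : Set} where

  -- In a list without repetitions both sublists must use the same occurrence of e.
  ⊆-join : ∀ {σ : List A} P {e S} → Unique σ →
           (P ++ [ e ]) ⊆ σ → (e ∷ S) ⊆ σ → (P ++ e ∷ S) ⊆ σ
  ⊆-join []      _        _          q          = q
  ⊆-join (a ∷ P) (_ ∷ uσ) (y ∷ʳ p)   (.y ∷ʳ q)  = y ∷ʳ ⊆-join (a ∷ P) uσ p q
  ⊆-join (a ∷ P) (y∉ ∷ _) (y ∷ʳ p)   (refl ∷ _) =
    ⊥-elim (All-lookup y∉ (Any-resp-⊆ p (∈-++⁺ʳ (a ∷ P) (here refl))) refl)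
  ⊆-join (a ∷ P) (_ ∷ uσ) (refl ∷ p) (.a ∷ʳ q)  = refl ∷ ⊆-join P uσ p q
  ⊆-join (a ∷ P) (a∉ ∷ _) (refl ∷ p) (refl ∷ _) =
    ⊥-elim (All-lookup a∉ (Any-resp-⊆ p (∈-++⁺ʳ P (here refl))) refl)

  Before : List A → A → A → Set
  Before σ a b = (a ∷ [ b ]) ⊆ σ

  Before-trans : ∀ {σ a b c} → Unique σ → Before σ a b → Before σ b c → Before σ a c
  Before-trans {b = b} uσ ab bc = ⊆-trans (refl ∷ b ∷ʳ ⊆-refl) (⊆-join [ _ ] uσ ab bc)

  Before-irrefl : ∀ {σ a} → Unique σ → ¬ Before σ a a
  Before-irrefl (_ ∷ uσ) (_ ∷ʳ p)   = Before-irrefl uσ p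
  Before-irrefl (a∉ ∷ _) (refl ∷ p) = All-lookup a∉ (to∈ p) refl

  Before-asym : ∀ {σ a b} → Unique σ → Before σ a b → ¬ Before σ b a
  Before-asym uσ ab ba = Before-irrefl uσ (Before-trans uσ ab ba)

  Before-total : ∀ {σ a b} → a ∈ σ → b ∈ σ → a ≢ b → Before σ a b ⊎ Before σ b a
  Before-total (here refl) (here refl) a≢b = ⊥-elim (a≢b refl)
  Before-total (here refl) (there b∈) _   = inj₁ (refl ∷ from∈ b∈)
  Before-total (there a∈)  (here refl) _  = inj₂ (refl ∷ from∈ a∈)
  Before-total (there a∈)  (there b∈) a≢b = ⊎-map (_ ∷ʳ_) (_ ∷ʳ_) (Before-total a∈ b∈ a≢b)

  ⊆⇒Before : ∀ {σ a b S} → (a ∷ b ∷ S) ⊆ σ → Before σ a b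
  ⊆⇒Before p = ⊆-trans (refl ∷ refl ∷ minimum _) p

Before⇒LeftOf : ∀ {σ a b} → Before σ a b → LeftOf σ a b
Before⇒LeftOf (y ∷ʳ p) with Before⇒LeftOf p
... | as , bs , cs , refl = y ∷ as , bs , cs , refl
Before⇒LeftOf (refl ∷ p) with ∈-∃++ (to∈ p)
... | bs , cs , refl = [] , bs , cs , refl

module _ {A : Set} {R : A → A → Set} where

  Linked-join : ∀ P {e S} → Linked R (P ++ [ e ]) → Linked R (e ∷ S) → Linked R (P ++ e ∷ S)
  Linked-join []          _         l = l
  Linked-join (a ∷ [])    (r ∷ _)   l = r ∷ l
  Linked-join (a ∷ b ∷ P) (r ∷ l′)  l = r ∷ Linked-join (b ∷ P) l′ l

  Linked-prefix : ∀ P {S} → Linked R (P ++ S) → Linked R P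
  Linked-prefix []          _       = []
  Linked-prefix (a ∷ [])    _       = [-]
  Linked-prefix (a ∷ b ∷ P) (r ∷ l) = r ∷ Linked-prefix (b ∷ P) l

  Linked-suffix : ∀ P {S} → Linked R (P ++ S) → Linked R S
  Linked-suffix []      l = l
  Linked-suffix (a ∷ P) l = Linked-suffix P (tail l)

AllPairs>-Before : ∀ {l a b} → AllPairs _>_ l → a ∈ l → b ∈ l → a > b → Before l a b
AllPairs>-Before _          (here refl) (here refl) a>b = ⊥-elim (<-irrefl refl a>b)
AllPairs>-Before _          (here refl) (there b∈)  _   = refl ∷ from∈ b∈
AllPairs>-Before (h> ∷ _)   (there a∈)  (here refl) a>b = ⊥-elim (<-asym a>b (All-lookup h> a∈))
AllPairs>-Before (_ ∷ l>)   (there a∈)  (there b∈)  a>b = _ ∷ʳ AllPairs>-Before l> a∈ b∈ a>b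

AllPairs>-∉ : ∀ P {y Q} → AllPairs _>_ (P ++ y ∷ Q) → y ∉ P
AllPairs>-∉ (p ∷ P) (p> ∷ _) (here refl) = <-irrefl refl (All-lookup p> (∈-++⁺ʳ P (here refl)))
AllPairs>-∉ (p ∷ P) (_ ∷ l>) (there y∈)  = AllPairs>-∉ P l> y∈

module _ {σ : List ℕ} where

  DecSub-[_] : ∀ {a} → a ∈ σ → DecSub σ [ a ]
  DecSub-[ a∈ ] = from∈ a∈ , [-]

  DecSub-prefix : ∀ P {S} → DecSub σ (P ++ S) → DecSub σ P
  DecSub-prefix P {S} (s , l) = ⊆-trans (++⁺ʳ S ⊆-refl) s , Linked-prefix P l

  DecSub-suffix : ∀ P {S} → DecSub σ (P ++ S) → DecSub σ S
  DecSub-suffix P (s , l) = ⊆-trans (++⁺ˡ P ⊆-refl) s , Linked-suffix P l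

  DecSub-tail : ∀ {a S} → DecSub σ (a ∷ S) → DecSub σ S
  DecSub-tail = DecSub-suffix [ _ ]

  DecSub-head : ∀ {a b S} → DecSub σ (a ∷ b ∷ S) → Before σ a b × a > b
  DecSub-head (s , a>b ∷ _) = ⊆⇒Before s , a>b

  DecSub-join : Unique σ → ∀ P {e S} → DecSub σ (P ++ [ e ]) → DecSub σ (e ∷ S) →
                DecSub σ (P ++ e ∷ S)
  DecSub-join uσ P (s , l) (s′ , l′) = ⊆-join P uσ s s′ , Linked-join P l l′

  DecSub-∷ : Unique σ → ∀ {a b S} → Before σ a b → a > b → DecSub σ (b ∷ S) →
             DecSub σ (a ∷ b ∷ S)
  DecSub-∷ uσ ab a>b = DecSub-join uσ [ _ ] (ab , a>b ∷ [-])

  DecSub-∷ʳ : Unique σ → ∀ P {a b} → DecSub σ (P ++ [ a ]) → Before σ a b → a > b →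
              DecSub σ ((P ++ [ a ]) ++ [ b ])
  DecSub-∷ʳ uσ P {a} {b} d ab a>b =
    subst (DecSub σ) (sym (++-assoc P [ a ] [ b ])) (DecSub-join uσ P d (ab , a>b ∷ [-]))

  DecSub-AllPairs : ∀ {l} → DecSub σ l → AllPairs _>_ l
  DecSub-AllPairs (_ , l) = Linked⇒AllPairs (flip <-trans) l

  DecSub-Before : ∀ {l a b} → DecSub σ l → a ∈ l → b ∈ l → a > b → Before σ a b
  DecSub-Before d a∈ b∈ a>b = ⊆-trans (AllPairs>-Before (DecSub-AllPairs d) a∈ b∈ a>b) (proj₁ d)

LabelExceeds : List ℕ → ℕ → ℕ → Set
LabelExceeds σ a n = Σ (List ℕ) λ e → DecSub σ (a ∷ e) × n ≤ length e

LabelExceeds-mono : ∀ {σ a m n} → m ≤ n → LabelExceeds σ a n → LabelExceeds σ a m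
LabelExceeds-mono m≤n (e , d , n≤e) = e , d , ≤-trans m≤n n≤e

module _ {σ : List ℕ} {k : ℕ} where

  GoodSuffix-DecSub : ∀ {s} → GoodSuffix σ k s → DecSub σ s
  GoodSuffix-DecSub (_ , d , _ , p , refl) = DecSub-suffix p d

  GoodSuffix-length : ∀ {s} → GoodSuffix σ k s → length s ≤ k
  GoodSuffix-length {s} (_ , _ , |d| , p , refl) =
    ≤-trans (m≤n+m (length s) (length p)) (≤-reflexive (trans (sym (length-++ p)) |d|))

  GoodSuffix-whole : ∀ {s} → GoodSuffix σ k s → length s ≡ k → DecSub σ s
  GoodSuffix-whole (_ , d , _ , [] , refl) _ = d
  GoodSuffix-whole {s} (_ , _ , |d| , q ∷ p , refl) |s| =
    ⊥-elim (m≢1+n+m (length s) (trans (trans |s| (sym |d|)) (cong suc (length-++ p))))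

  GoodSuffix-trim : ∀ Q {t} → DecSub σ (Q ++ t) → length t ≤ k → k ≤ length (Q ++ t) →
                    GoodSuffix σ k t
  GoodSuffix-trim [] {t} d t≤k k≤t = t , d , ≤-antisym t≤k k≤t , [] , refl
  GoodSuffix-trim (q ∷ Q) {t} d t≤k k≤ with k ≟ length (q ∷ Q ++ t)
  ... | yes k≡ = q ∷ Q ++ t , d , sym k≡ , q ∷ Q , refl
  ... | no k≢  = GoodSuffix-trim Q (DecSub-tail d) t≤k (m<1+n⇒m≤n (≤∧≢⇒< k≤ k≢))

  IsBTail-good : ∀ {y s} → IsBTail σ k (y ∷ s) → GoodSuffix σ k (y ∷ s)
  IsBTail-good (cons _ g _) = g

  IsBTail-DecSub : ∀ {y s} → IsBTail σ k (y ∷ s) → DecSub σ (y ∷ s)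
  IsBTail-DecSub = GoodSuffix-DecSub ∘ IsBTail-good

  IsBTail-tail : ∀ {y s} → IsBTail σ k (y ∷ s) → IsBTail σ k s
  IsBTail-tail (cons bt _ _) = bt

  IsBTail-suffix : ∀ P {s} → IsBTail σ k (P ++ s) → IsBTail σ k s
  IsBTail-suffix []      bt = bt
  IsBTail-suffix (_ ∷ P) bt = IsBTail-suffix P (IsBTail-tail bt)

module _ {π : List ℕ} (uπ : Unique π) {k : ℕ} where

  IsBTail-leftmost : ∀ {y s z} → IsBTail π k (y ∷ s) → Before π z y →
                     ∀ Q → DecSub π (Q ++ [ z ]) → DecSub π (z ∷ s) →
                     k ≤ length Q + length (z ∷ s) → ⊥
  IsBTail-leftmost {z = z} (cons _ g leftmost) zy Q dQ dz long =
    leftmost z (Before⇒LeftOf zy)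
      (GoodSuffix-trim Q (DecSub-join uπ Q dQ dz) (GoodSuffix-length g)
        (subst (k ≤_) (sym (length-++ Q)) long))

  -- The bound on length Q makes Q ++ [ z ] long enough for z to replace y in a decreasing
  -- subsequence of length k ending in y ∷ s (for Q ++ [ w ], a letter after w can), so
  -- IsBTail-leftmost applies as soon as such a letter precedes y and fits in front of s.
  mutual
    IsBTail-label-≥ : ∀ {y s w e} → IsBTail π k (y ∷ s) →
                      ∀ Q → DecSub π (Q ++ [ w ]) → k ≤ length Q + length (w ∷ y ∷ s) →
                      Before π w y → w < y → DecSub π (w ∷ e) →
                      LabelExceeds π y (length e)
    IsBTail-label-≥ {e = []} bt Q dQ long wy w<y dw =
      [] , DecSub-[ Any-resp-⊆ wy (there (here refl)) ] , z≤n
    IsBTail-label-≥ {y} {s} {w} {e₂ ∷ e} bt Q dQ long wy w<y dw with DecSub-head dw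
    ... | we₂ , w>e₂ with Before-total (Any-resp-⊆ we₂ (there (here refl)))
                                       (Any-resp-⊆ wy (there (here refl)))
                                       (<⇒≢ (<-trans w>e₂ w<y))
    ...   | inj₂ ye₂ = e₂ ∷ e , DecSub-∷ uπ ye₂ (<-trans w>e₂ w<y) (DecSub-tail dw) , ≤-refl
    ...   | inj₁ e₂y = IsBTail-label-> bt (Q ++ [ w ]) (DecSub-∷ʳ uπ Q dQ we₂ w>e₂) long′ e₂y
                         (<-trans w>e₂ w<y) (DecSub-tail dw)
      where
      long′ : k ≤ length (Q ++ [ w ]) + length (e₂ ∷ s)
      long′ = subst (k ≤_) (trans (+-suc (length Q) (length (e₂ ∷ s)))
                                  (cong (_+ length (e₂ ∷ s)) (sym (length-∷ʳ Q)))) long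

    IsBTail-label-> : ∀ {y s z e} → IsBTail π k (y ∷ s) →
                      ∀ Q → DecSub π (Q ++ [ z ]) → k ≤ length Q + length (z ∷ s) →
                      Before π z y → z < y → DecSub π (z ∷ e) →
                      LabelExceeds π y (suc (length e))
    IsBTail-label-> {s = []} bt Q dQ long zy z<y dz =
      ⊥-elim (IsBTail-leftmost bt zy Q dQ (DecSub-prefix [ _ ] dz) long)
    IsBTail-label-> {y} {c ∷ S} {z} bt Q dQ long zy z<y dz
      with DecSub-head (IsBTail-DecSub bt) | <-cmp z c
    ... | yc , _   | tri≈ _ refl _ = ⊥-elim (Before-asym uπ zy yc)
    ... | yc , _   | tri> _ _ z>c  =
      ⊥-elim (IsBTail-leftmost bt zy Q dQ
               (DecSub-∷ uπ (Before-trans uπ zy yc) z>c (IsBTail-DecSub (IsBTail-tail bt))) long)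
    ... | yc , y>c | tri< z<c _ _
      with IsBTail-label-≥ (IsBTail-tail bt) Q dQ long (Before-trans uπ zy yc) z<c dz
    ...   | e′ , dc , |e|≤|e′| = c ∷ e′ , DecSub-∷ uπ yc y>c dc , s≤s |e|≤|e′|

repl-≡ : ∀ a as c cs → repl (a ∷ as) (c ∷ cs) a ≡ c
repl-≡ a _ _ _ with a ≡ᵇ a | ≡⇒≡ᵇ a a refl
... | true  | _ = refl
... | false | ()

repl-≢ : ∀ {y a as c cs} → y ≢ a → repl (a ∷ as) (c ∷ cs) y ≡ repl as cs y
repl-≢ {y} {a} y≢a with y ≡ᵇ a | ≡ᵇ⇒≡ y a
... | false | _   = refl
... | true  | y≡a = ⊥-elim (y≢a (y≡a _))

repl-∉ : ∀ as cs {y} → y ∉ as → repl as cs y ≡ y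
repl-∉ []       _        _  = refl
repl-∉ (_ ∷ _)  []       _  = refl
repl-∉ (a ∷ as) (c ∷ cs) y∉ =
  trans (repl-≢ {as = as} {cs = cs} (y∉ ∘ here)) (repl-∉ as cs (y∉ ∘ there))

repl-at : ∀ P P′ {y Q c Q′} → y ∉ P → length P ≡ length P′ →
          repl (P ++ y ∷ Q) (P′ ++ c ∷ Q′) y ≡ c
repl-at []      []       {y} {Q} {c} {Q′} _ _ = repl-≡ y Q c Q′
repl-at (_ ∷ P) (_ ∷ P′) {y} {Q} {c} {Q′} y∉ eq =
  trans (repl-≢ {as = P ++ y ∷ Q} {cs = P′ ++ c ∷ Q′} (y∉ ∘ here))
        (repl-at P P′ (y∉ ∘ there) (suc-injective eq))

rot-∷-∷ : ∀ P {y c Q} → ∃₂ λ P′ Q′ → rot (P ++ y ∷ c ∷ Q) ≡ P′ ++ c ∷ Q′ × length P′ ≡ length P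
rot-∷-∷ []      {y} {Q = Q} = [] , Q ++ [ y ] , refl , refl
rot-∷-∷ (p ∷ P) {y} {c} {Q} =
  P ++ [ y ] , Q ++ [ p ] , trans (++-assoc P _ _) (sym (∷ʳ-++ P y _)) , length-∷ʳ P

module Shift {π : List ℕ} (uπ : Unique π) {k bk : ℕ} {rest : List ℕ}
             (bt : IsBTail π k (bk ∷ rest)) (|B| : length (bk ∷ rest) ≡ k) where

  B : List ℕ
  B = bk ∷ rest

  shift : ℕ → ℕ
  shift = repl B (rot B)

  B-DecSub : DecSub π B
  B-DecSub = GoodSuffix-whole (IsBTail-good bt) |B|

  B-∈ : ∀ {a} → a ∈ B → a ∈ π
  B-∈ = Any-resp-⊆ (proj₁ B-DecSub)


  data ShiftView (y : ℕ) : Set where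
    fixed : shift y ≡ y → ShiftView y
    next  : ∀ P {c} Q → B ≡ P ++ y ∷ c ∷ Q → shift y ≡ c → ShiftView y
    last  : ∀ P → B ≡ P ++ [ y ] → shift y ≡ bk → ShiftView y

  shift-next : ∀ P {y c Q} → B ≡ P ++ y ∷ c ∷ Q → shift y ≡ c
  shift-next P {y} {c} {Q} eq with rot-∷-∷ P {y} {c} {Q}
  ... | P′ , Q′ , rot≡ , |P′| = begin
    repl B (rot B) y
      ≡⟨ cong (λ l → repl l (rot l) y) eq ⟩
    repl (P ++ y ∷ c ∷ Q) (rot (P ++ y ∷ c ∷ Q)) y
      ≡⟨ cong (λ r → repl (P ++ y ∷ c ∷ Q) r y) rot≡ ⟩
    repl (P ++ y ∷ c ∷ Q) (P′ ++ c ∷ Q′) y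
      ≡⟨ repl-at P P′ y∉P (sym |P′|) ⟩
    c ∎
    where
    open ≡-Reasoning
    y∉P = AllPairs>-∉ P (subst (AllPairs _>_) eq (DecSub-AllPairs B-DecSub))

  shift-last : ∀ P {y} → B ≡ P ++ [ y ] → shift y ≡ bk
  shift-last P {y} eq = begin
    repl B (rest ++ [ bk ]) y            ≡⟨ cong (λ l → repl l (rest ++ [ bk ]) y) eq ⟩
    repl (P ++ [ y ]) (rest ++ [ bk ]) y ≡⟨ repl-at P rest y∉P |P| ⟩
    bk                                   ∎
    where
    open ≡-Reasoning
    y∉P = AllPairs>-∉ P (subst (AllPairs _>_) eq (DecSub-AllPairs B-DecSub))
    |P| = suc-injective (sym (trans (cong length eq) (length-∷ʳ P)))

  shift-view : ∀ y → ShiftView y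
  shift-view y with y ∈? B
  ... | no y∉ = fixed (repl-∉ B (rot B) y∉)
  ... | yes y∈ with ∈-∃++ y∈
  ...   | P , c ∷ Q , eq = next P Q eq (shift-next P eq)
  ...   | P , []    , eq = last P eq (shift-last P eq)

  B-suffix : ∀ P {y s} → B ≡ P ++ y ∷ s → DecSub π (y ∷ s)
  B-suffix P eq = DecSub-suffix P (subst (DecSub π) eq B-DecSub)

  B-inversion : ∀ {a b} → a ∈ B → b ∈ B → a > b → ¬ Before π b a
  B-inversion a∈ b∈ a>b = Before-asym uπ (DecSub-Before B-DecSub a∈ b∈ a>b)

  next-∈ : ∀ P {y c Q} → B ≡ P ++ y ∷ c ∷ Q → shift y ≡ c → shift y ∈ B
  next-∈ P eq refl = subst (_ ∈_) (sym eq) (∈-++⁺ʳ P (there (here refl)))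

  last-∈ : ∀ {y} → shift y ≡ bk → shift y ∈ B
  last-∈ fy = subst (_∈ B) (sym fy) (here refl)

  shift-∈ : ∀ {y} → y ∈ π → shift y ∈ π
  shift-∈ {y} y∈ with shift-view y
  ... | fixed fy       = subst (_∈ π) (sym fy) y∈
  ... | next P _ eq fy = B-∈ (next-∈ P eq fy)
  ... | last _ _ fy    = B-∈ (last-∈ fy)

  between-label : ∀ P {u c Q v e} → B ≡ P ++ u ∷ c ∷ Q → Before π u v → Before π v c → v < c →
                  DecSub π (v ∷ e) → LabelExceeds π c (suc (length e))
  between-label P {u} {c} {Q} {v} eq uv vc v<c dv =
    IsBTail-label-> uπ (IsBTail-suffix (P ++ [ u ]) (subst (IsBTail π k) eq′ bt))
      (P ++ [ u ]) (DecSub-∷ʳ uπ P dP uv (<-trans v<c u>c)) long vc v<c dv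
    where
    u>c : u > c
    u>c = proj₂ (DecSub-head (B-suffix P eq))
    eq′ : B ≡ (P ++ [ u ]) ++ c ∷ Q
    eq′ = trans eq (sym (∷ʳ-++ P u (c ∷ Q)))
    dP : DecSub π (P ++ [ u ])
    dP = DecSub-prefix (P ++ [ u ]) (subst (DecSub π) eq′ B-DecSub)
    long : k ≤ length (P ++ [ u ]) + length (v ∷ Q)
    long = ≤-reflexive (trans (sym |B|) (trans (cong length eq′) (length-++ (P ++ [ u ]))))

  shift-crossing : ∀ {u v e} → Before π u v → shift u > shift v → shift u ≤ bk →
                   Before π (shift v) (shift u) → DecSub π (shift v ∷ e) →
                   LabelExceeds π (shift u) (suc (length e))
  shift-crossing {u} {v} {e} uv u>v u≤bk vu dv with shift-view u | shift-view v
  ... | fixed fu | fixed fv = ⊥-elim (Before-asym uπ uv (subst₂ (Before π) fv fu vu))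
  ... | fixed fu | next P Q eq fv =
    ⊥-elim (Before-asym uπ (Before-trans uπ uv (proj₁ (DecSub-head (B-suffix P eq))))
                           (subst₂ (Before π) fv fu vu))
  ... | fixed _  | last _ _ fv = ⊥-elim (<⇒≱ (subst (_< shift u) fv u>v) u≤bk)
  ... | last P eq fu | fixed fv = ⊥-elim (bk-first (subst (u ∈_) (sym eq) (∈-++⁺ʳ P (here refl))))
    where
    v<bk : Before π v bk
    v<bk = subst₂ (Before π) fv fu vu
    bk-first : u ∈ B → ⊥
    bk-first (here refl) = Before-asym uπ uv v<bk
    bk-first (there u∈)  =
      Before-asym uπ uv (Before-trans uπ v<bk (⊆-trans (refl ∷ from∈ u∈) (proj₁ B-DecSub)))
  ... | next P Q eq fu | fixed fv =
    subst (λ a → LabelExceeds π a (suc (length e))) (sym fu)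
      (between-label P eq uv (subst₂ (Before π) fv fu vu) (subst₂ _<_ fv fu u>v)
                             (subst (λ a → DecSub π (a ∷ e)) fv dv))
  ... | next P _ eq fu | next P′ _ eq′ fv =
    ⊥-elim (B-inversion (next-∈ P eq fu) (next-∈ P′ eq′ fv) u>v vu)
  ... | next P _ eq fu | last _ _ fv      = ⊥-elim (B-inversion (next-∈ P eq fu) (last-∈ fv) u>v vu)
  ... | last _ _ fu    | next P′ _ eq′ fv =
    ⊥-elim (B-inversion (last-∈ fu) (next-∈ P′ eq′ fv) u>v vu)
  ... | last _ _ fu    | last _ _ fv      = ⊥-elim (B-inversion (last-∈ fu) (last-∈ fv) u>v vu)

  shift-label : ∀ c {u} → (u ∷ c) ⊆ π → Linked (_>_ on shift) (u ∷ c) → shift u ≤ bk →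
                LabelExceeds π (shift u) (length c)
  shift-label []      u⊆ _ _ = [] , DecSub-[ shift-∈ (to∈ u⊆) ] , z≤n
  shift-label (v ∷ c) uvc⊆ (u>v ∷ ↓) u≤bk
    with shift-label c (∷ˡ⁻ uvc⊆) ↓ (≤-trans (<⇒≤ u>v) u≤bk)
  ... | e , dv , |c|≤|e|
    with Before-total (shift-∈ (Any-resp-⊆ uvc⊆ (here refl)))
                      (shift-∈ (Any-resp-⊆ uvc⊆ (there (here refl)))) (>⇒≢ u>v)
  ...   | inj₁ uv = shift _ ∷ e , DecSub-∷ uπ uv u>v dv , s≤s |c|≤|e|
  ...   | inj₂ vu = LabelExceeds-mono (s≤s |c|≤|e|) (shift-crossing (⊆⇒Before uvc⊆) u>v u≤bk vu dv)

  ψ-LabelExceeds : ∀ {x d} → DecSub (map shift π) (x ∷ d) → x ≤ bk → LabelExceeds π x (length d)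
  ψ-LabelExceeds (xd⊆ , xd↓) x≤bk with ⊆-map-preimage shift π xd⊆
  ... | u ∷ c , uc⊆ , refl =
    LabelExceeds-mono (≤-reflexive (length-map shift c)) (shift-label c uc⊆ (map⁻ xd↓) x≤bk)

lemma25 : (k n : ℕ) → 2 ≤ k → (π : List ℕ) → IsPerm n π →
          (Σ (List ℕ) λ d → DecSub π d × (length d ≡ k)) →
          (bk : ℕ) (rest : List ℕ) → IsBSeq π k (bk ∷ rest) →
          (x : ℕ) → x ∈ π → x ≤ bk →
          (L₁ L₂ : ℕ) → IsLabel (ψ (bk ∷ rest) π) x L₁ → IsLabel π x L₂ →
          L₁ ≤ L₂
lemma25 k n _ π π↭ _ bk rest (bt , |B|) x _ x≤bk L₁ L₂ ((d , xd , |xd|) , _) (_ , maximal)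
  with Shift.ψ-LabelExceeds (IsPerm⇒Unique π↭) bt |B| xd x≤bk
... | e , xe , |d|≤|e| = begin
  L₁             ≡⟨ sym |xd| ⟩
  suc (length d) ≤⟨ s≤s |d|≤|e| ⟩
  suc (length e) ≤⟨ maximal e xe ⟩
  L₂             ∎
  where open ≤-Reasoning
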